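{- Let $m\ge 1$ be an integer and $g=30m+17$. There exists an almost $5$-star factor $F$ on $\{0,1,\dots,30m+16\}$ with $t=5$ isolated vertices such that: (i) every $d\in\{1,2,\dots,15m+8\}$ is the forward difference of at least one edge of $F$; (ii) every $d\in\{1,2,\dots,15m+8\}$ is the forward difference of at most two edges of $F$; (iii) $F$ has no wrap-around edges; (iv) there is a pure/prime labelling of $F$ with respect to which exactly one of the $5$-star components of $F$ is mixed and the little star (a star with $4$ edges on the $5$ isolated vertices) is a prime star.
   Context: Let $g\ge 1$ and $t\in\{0,\dots,5\}$ with $g\equiv t\pmod 6$. An almost $5$-star factor on $\{0,1,\dots,g-1\}$ with $t$ isolated vertices is a graph $F$ on this vertex set such that the vertex set is partitioned into $(g-t)/6$ six-element sets, each spanning a connected component of $F$ isomorphic to $K_{1,5}$ (a $5$-star), and one $t$-element set $X$ (the isolated vertices) on which $F$ induces a star $K_{1,t-1}$ (the little star), and $F$ has no other edges. For an edge $\{u,w\}$ with $u<w$, its difference is $\min\{w-u,\,g-(w-u)\}$; the edge is a forward edge if its difference equals $w-u$ (and then $w-u$ is its forward difference), and a wrap-around edge otherwise. A pure/prime labelling of $F$ assigns to each edge of $F$ one of the labels "pure" or "prime" so that no two pure edges have the same difference and no two prime edges have the same difference. With respect to such a labelling, a star is pure (resp. prime) if all its edges are pure (resp. prime), and mixed if it contains both a pure and a prime edge. -}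

module Defs where

open import Data.Nat using (ℕ; _+_; _*_; _∸_; _/_; _≤_; ∣_-_∣; _⊓_; _≡ᵇ_)
open import Data.Bool using (Bool; true; false; _∧_; if_then_else_)
open import Data.Fin using (Fin)
open import Data.Vec using (Vec; toList; zipWith)
open import Data.List using (List; []; _∷_; _++_; map; concatMap; tabulate; upTo; length)
open import Data.Product using (_×_; _,_; proj₁; proj₂; Σ)
open import Data.List.Relation.Unary.Any using (Any)
open import Data.List.Relation.Unary.Unique.Propositional using (Unique)
open import Data.List.Relation.Binary.Permutation.Propositional using (_↭_)
open import Relation.Binary.PropositionalEquality using (_≡_; _≢_)
open import Relation.Nullary using (¬_)

Star : ℕ → Set
Star k = ℕ × Vec ℕ k

starVertices : ∀ {k} → Star k → List ℕ
starVertices (c , ls) = c ∷ toList ls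

starEdges : ∀ {k} → Star k → List (ℕ × ℕ)
starEdges (c , ls) = map (λ l → (c , l)) (toList ls)

-- An almost 5-star factor on {0,…,g-1} with t ≥ 1 isolated vertices:
-- (g - t)/6 five-stars and one little star K_{1,t-1}, whose vertex sets
-- together partition {0,…,g-1} (expressed as: the list of all their
-- vertices is a permutation of [0,…,g-1]).

record AlmostFiveStarFactor (g t : ℕ) : Set where
  field
    t≥1    : 1 ≤ t
    stars  : Fin ((g ∸ t) / 6) → Star 5
    little : Star (t ∸ 1)
    partition : (concatMap starVertices (tabulate stars) ++ starVertices little) ↭ upTo g

  edges : List (ℕ × ℕ)
  edges = concatMap starEdges (tabulate stars) ++ starEdges little

open AlmostFiveStarFactor public

diff : ℕ → ℕ × ℕ → ℕ
diff g (u , w) = ∣ u - w ∣ ⊓ (g ∸ ∣ u - w ∣)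

dist : ℕ × ℕ → ℕ
dist (u , w) = ∣ u - w ∣

Forward : ℕ → ℕ × ℕ → Set
Forward g e = diff g e ≡ dist e

hasFwdDiff : ℕ → ℕ → ℕ × ℕ → Bool
hasFwdDiff g d e = (diff g e ≡ᵇ dist e) ∧ (dist e ≡ᵇ d)

fwdCount : ℕ → ℕ → List (ℕ × ℕ) → ℕ
fwdCount g d [] = 0
fwdCount g d (e ∷ es) = (if hasFwdDiff g d e then 1 else 0) + fwdCount g d es

data Label : Set where
  pure prime : Label

sameLabel : Label → Label → Bool
sameLabel pure  pure  = true
sameLabel prime prime = true
sameLabel _     _     = false

record Labelling {g t : ℕ} (F : AlmostFiveStarFactor g t) : Set where
  field
    starLabels   : Fin ((g ∸ t) / 6) → Vec Label 5
    littleLabels : Vec Label (t ∸ 1)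

labelledStarEdges : ∀ {k} → Star k → Vec Label k → List (Label × (ℕ × ℕ))
labelledStarEdges (c , ls) labs = toList (zipWith (λ l lab → (lab , (c , l))) ls labs)

labelledEdges : ∀ {g t} (F : AlmostFiveStarFactor g t) → Labelling F → List (Label × (ℕ × ℕ))
labelledEdges F L =
  concatMap (λ i → labelledStarEdges (stars F i) (Labelling.starLabels L i))
            (tabulate (λ i → i))
  ++ labelledStarEdges (little F) (Labelling.littleLabels L)

diffsWithLabel : ℕ → Label → List (Label × (ℕ × ℕ)) → List ℕ
diffsWithLabel g ℓ [] = []
diffsWithLabel g ℓ ((ℓ' , e) ∷ xs) =
  if sameLabel ℓ ℓ' then diff g e ∷ diffsWithLabel g ℓ xs else diffsWithLabel g ℓ xs

IsPurePrime : ∀ {g t} (F : AlmostFiveStarFactor g t) → Labelling F → Set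
IsPurePrime {g} F L =
  Unique (diffsWithLabel g pure (labelledEdges F L)) ×
  Unique (diffsWithLabel g prime (labelledEdges F L))

Mixed : ∀ {k} → Vec Label k → Set
Mixed labs = Any (_≡ pure) (toList labs) × Any (_≡ prime) (toList labs)

PrimeStar : ∀ {k} → Vec Label k → Set
PrimeStar labs = Data.List.Relation.Unary.All.All (_≡ prime) (toList labs)
  where import Data.List.Relation.Unary.All

ExactlyOneMixed : ∀ {g t} {F : AlmostFiveStarFactor g t} → Labelling F → Set
ExactlyOneMixed {g} {t} L =
  Σ (Fin ((g ∸ t) / 6)) λ i → Mixed (Labelling.starLabels L i) ×
    (∀ j → j ≢ i → ¬ Mixed (Labelling.starLabels L j))

{-# OPTIONS --safe #-}
module Submission where

-- Write g = 2H + 1.  If every edge joins u < w with w - u ≤ H, then all edges are forward and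
-- an edge's difference is its length, so it suffices to realise each length 1, …, H by at least
-- one edge, with no length carried twice by edges of the same label.  Most of the work is done
-- by two families of monochromatic 5-stars: the k-th prime star has lengths 6k + 6, …, 6k + 10
-- and the k-th pure star 6k + 7, …, 6k + 11, so together they realise every length from 6 on.
-- Placing the centres of a family on consecutive vertices and their leaves in consecutive
-- blocks of five further right makes the vertices of a family fill two intervals; the gap
-- between them holds the little star (lengths 1, …, 4, prime) or a star with lengths 1, …, 5.
-- Two further stars X and Y, one of them the star in that gap, pick up the remaining smallest
-- and largest lengths and the leftover vertices; X is the unique mixed star.  The construction
-- works for g = 12p + 17 and g = 12p + 23, which covers even and odd m.

open import Defs
open import Data.Bool using (true; false; if_then_else_; T)
open import Data.Empty using (⊥-elim)
open import Data.Fin using (Fin; zero; suc; cast)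
open import Data.List using (List; []; _∷_; _++_; map; concat; concatMap; length; lookup; tabulate; upTo)
open import Data.List.Properties using (length-++; map-++; concatMap-++; map-tabulate; upTo-∷ʳ; ++-identityʳ; ++-assoc)
open import Data.Vec.Properties using (length-toList)
open import Data.List.Membership.Propositional using (_∈_)
open import Data.List.Membership.Propositional.Properties using (∈-++⁺ˡ; ∈-++⁺ʳ; ∈-++⁻; ∈-∃++; ∈-lookup)
open import Data.List.Relation.Binary.Disjoint.Propositional using (Disjoint)
open import Data.List.Relation.Binary.Disjoint.Propositional.Properties using () renaming (sym to disjoint-sym)
open import Data.List.Relation.Binary.Permutation.Propositional using (_↭_; ↭-refl; ↭-trans; prep)
open import Data.List.Relation.Binary.Permutation.Propositional.Properties using (shift; ∷↭∷ʳ)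
open import Data.List.Relation.Unary.All using (All; []; _∷_)
import Data.List.Relation.Unary.All as All
import Data.List.Relation.Unary.All.Properties as All
open import Data.List.Relation.Unary.AllPairs using ([]; _∷_)
open import Data.List.Relation.Unary.Any using (here; there)
open import Data.List.Relation.Unary.Unique.Propositional using (Unique)
import Data.List.Relation.Unary.Unique.Propositional.Properties as Unique
open import Data.Nat using (ℕ; zero; suc; _+_; _*_; _∸_; _/_; _≤_; _<_; z≤n; s≤s; s≤s⁻¹; ∣_-_∣; _≡ᵇ_; _≟_; _<?_)
open import Data.Nat.DivMod using (m*n/n≡m)
open import Data.Nat.Properties
open import Algebra.Properties.CommutativeSemigroup +-commutativeSemigroup using (x∙yz≈y∙xz)
open import Data.Nat.Tactic.RingSolver using (solve-∀)
open import Data.Product using (_×_; _,_; proj₂; ∃; Σ)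
open import Data.Sum using (_⊎_; inj₁; inj₂)
open import Data.Unit using (tt)
open import Data.Vec using (Vec; []; _∷_; toList) renaming (map to vmap)
open import Function using (_∘_)
open import Relation.Binary.PropositionalEquality
open import Relation.Nullary using (¬_; yes; no)

n≡m+o⇒∣m-n∣≡o : ∀ m n {o} → n ≡ m + o → ∣ m - n ∣ ≡ o
n≡m+o⇒∣m-n∣≡o m _ {o} refl = ∣m-m+n∣≡n m o

m≡n+o⇒∣m-n∣≡o : ∀ m n {o} → m ≡ n + o → ∣ m - n ∣ ≡ o
m≡n+o⇒∣m-n∣≡o m n eq = trans (∣-∣-comm m n) (n≡m+o⇒∣m-n∣≡o n m eq)

window-offset : ∀ {x v k} → x ≤ v → v < x + k → ∃ λ t → t < k × v ≡ x + t
window-offset {x} x≤v v<x+k with m≤n⇒∃[o]m+o≡n x≤v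
... | t , refl = t , +-cancelˡ-< x t _ v<x+k , refl

five : ∀ {A : Set} → (ℕ → A) → Vec A 5
five h = h 4 ∷ h 3 ∷ h 2 ∷ h 1 ∷ h 0 ∷ []

∈-five : ∀ {A : Set} (h : ℕ → A) {t} → t < 5 → h t ∈ toList (five h)
∈-five h {0} _ = there (there (there (there (here refl))))
∈-five h {1} _ = there (there (there (here refl)))
∈-five h {2} _ = there (there (here refl))
∈-five h {3} _ = there (here refl)
∈-five h {4} _ = here refl
∈-five h {suc (suc (suc (suc (suc _))))} (s≤s (s≤s (s≤s (s≤s (s≤s ())))))

five⁺ : ∀ {A : Set} {P : A → Set} {h : ℕ → A} → (∀ {t} → t < 5 → P (h t)) → All P (toList (five h))
five⁺ p = p (n<1+n 4) ∷ p (m<n⇒m<1+n (n<1+n 3)) ∷ p (s≤s (s≤s (s≤s z≤n)))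
        ∷ p (s≤s (s≤s z≤n)) ∷ p (s≤s z≤n) ∷ []

five-unique : ∀ {A : Set} {h : ℕ → A} → (∀ {s t} → h s ≡ h t → s ≡ t) → Unique (toList (five h))
five-unique inj = ((λ ()) ∘ inj ∷ (λ ()) ∘ inj ∷ (λ ()) ∘ inj ∷ (λ ()) ∘ inj ∷ [])
                ∷ ((λ ()) ∘ inj ∷ (λ ()) ∘ inj ∷ (λ ()) ∘ inj ∷ [])
                ∷ ((λ ()) ∘ inj ∷ (λ ()) ∘ inj ∷ [])
                ∷ ((λ ()) ∘ inj ∷ []) ∷ [] ∷ []

separated⇒disjoint : ∀ {xs ys} b → All (_< b) xs → All (b ≤_) ys → Disjoint xs ys
separated⇒disjoint b xs<b b≤ys (x∈xs , x∈ys) = <⇒≱ (All.lookup xs<b x∈xs) (All.lookup b≤ys x∈ys)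

unique-++-below : ∀ b {xs ys} → Unique xs → Unique ys → All (_< b) xs → All (b ≤_) ys → Unique (xs ++ ys)
unique-++-below b uxs uys xs<b b≤ys = Unique.++⁺ uxs uys (separated⇒disjoint b xs<b b≤ys)

unique-++-above : ∀ b {xs ys} → Unique xs → Unique ys → All (b ≤_) xs → All (_< b) ys → Unique (xs ++ ys)
unique-++-above b uxs uys b≤xs ys<b = Unique.++⁺ uxs uys (disjoint-sym (separated⇒disjoint b ys<b b≤xs))

occurrences : ℕ → List ℕ → ℕ
occurrences d [] = 0
occurrences d (x ∷ xs) = (if x ≡ᵇ d then 1 else 0) + occurrences d xs

≡ᵇ-refl : ∀ n → (n ≡ᵇ n) ≡ true
≡ᵇ-refl zero = refl
≡ᵇ-refl (suc n) = ≡ᵇ-refl n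

occurrences-∉ : ∀ d xs → All (d ≢_) xs → occurrences d xs ≡ 0
occurrences-∉ d [] [] = refl
occurrences-∉ d (x ∷ xs) (d≢x ∷ d∉xs) with x ≡ᵇ d in eq
... | true = ⊥-elim (d≢x (sym (≡ᵇ⇒≡ x d (subst T (sym eq) tt))))
... | false = occurrences-∉ d xs d∉xs

occurrences-unique : ∀ d xs → Unique xs → occurrences d xs ≤ 1
occurrences-unique d [] _ = z≤n
occurrences-unique d (x ∷ xs) (x∉xs ∷ u) with x ≡ᵇ d in eq
... | false = occurrences-unique d xs u
... | true with ≡ᵇ⇒≡ x d (subst T (sym eq) tt)
...   | refl rewrite occurrences-∉ d xs x∉xs = ≤-refl

occurrences-∈ : ∀ d xs → d ∈ xs → 1 ≤ occurrences d xs
occurrences-∈ d (x ∷ xs) (here refl) rewrite ≡ᵇ-refl d = s≤s z≤n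
occurrences-∈ d (x ∷ xs) (there d∈xs) = ≤-trans (occurrences-∈ d xs d∈xs) (m≤n+m _ _)

↭-upTo : ∀ n xs → length xs ≡ n → (∀ v → v < n → v ∈ xs) → xs ↭ upTo n
↭-upTo zero [] _ _ = ↭-refl
↭-upTo (suc n) xs len cover with ∈-∃++ (cover n ≤-refl)
... | as , bs , refl =
  ↭-trans (shift n as bs)
    (↭-trans (prep n (↭-upTo n (as ++ bs) len′ cover′))
      (subst (n ∷ upTo n ↭_) (upTo-∷ʳ n) (∷↭∷ʳ n (upTo n))))
  where
  len′ : length (as ++ bs) ≡ n
  len′ = suc-injective (begin
    suc (length (as ++ bs))     ≡⟨ cong suc (length-++ as) ⟩
    suc (length as + length bs) ≡⟨ sym (+-suc (length as) (length bs)) ⟩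
    length as + length (n ∷ bs) ≡⟨ sym (length-++ as) ⟩
    length (as ++ n ∷ bs)       ≡⟨ len ⟩
    suc n                       ∎)
    where open ≡-Reasoning
  cover′ : ∀ v → v < n → v ∈ as ++ bs
  cover′ v v<n with ∈-++⁻ as (cover v (m<n⇒m<1+n v<n))
  ... | inj₁ v∈as = ∈-++⁺ˡ v∈as
  ... | inj₂ (here refl) = ⊥-elim (<-irrefl refl v<n)
  ... | inj₂ (there v∈bs) = ∈-++⁺ʳ as v∈bs

uniform⇒¬Mixed : ∀ {k ℓ} (labs : Vec Label k) → All (_≡ ℓ) (toList labs) → ¬ Mixed labs
uniform⇒¬Mixed labs ≡ℓ (somePure , somePrime)
  with All.lookupAny ≡ℓ somePure | All.lookupAny ≡ℓ somePrime
... | x≡ℓ , x≡pure | y≡ℓ , y≡prime with trans (sym x≡pure) (trans x≡ℓ (trans (sym y≡ℓ) y≡prime))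
... | ()

-- A leaf records its vertex, its label and the difference it is meant to realise.
Leaf : Set
Leaf = ℕ × Label × ℕ

LabelledStar : ℕ → Set
LabelledStar k = ℕ × Vec Leaf k

leafVertex : Leaf → ℕ
leafVertex (l , _ , _) = l

leafLabel : Leaf → Label
leafLabel (_ , ℓ , _) = ℓ

shape : ∀ {k} → LabelledStar k → Star k
shape (c , ls) = c , vmap leafVertex ls

labels : ∀ {k} → LabelledStar k → Vec Label k
labels (_ , ls) = vmap leafLabel ls

vertices : ∀ {k} → LabelledStar k → List ℕ
vertices σ = starVertices (shape σ)

labelledEdgesOf : ∀ {k} → LabelledStar k → List (Label × (ℕ × ℕ))
labelledEdgesOf σ = labelledStarEdges (shape σ) (labels σ)

leafDiffs : ∀ {k} → Label → Vec Leaf k → List ℕ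
leafDiffs ℓ [] = []
leafDiffs ℓ ((_ , ℓ′ , d) ∷ ls) = if sameLabel ℓ ℓ′ then d ∷ leafDiffs ℓ ls else leafDiffs ℓ ls

diffsOf : ∀ {k} → Label → LabelledStar k → List ℕ
diffsOf ℓ (_ , ls) = leafDiffs ℓ ls

ShortLeaf : ℕ → ℕ → Leaf → Set
ShortLeaf H c (l , _ , d) = ∣ c - l ∣ ≡ d × d ≤ H

Short : ℕ → ∀ {k} → LabelledStar k → Set
Short H (c , ls) = All (ShortLeaf H c) (toList ls)

edges-labelledEdgesOf : ∀ {k} (σ : LabelledStar k) → map proj₂ (labelledEdgesOf σ) ≡ starEdges (shape σ)
edges-labelledEdgesOf (c , []) = refl
edges-labelledEdgesOf (c , l ∷ ls) = cong ((c , leafVertex l) ∷_) (edges-labelledEdgesOf (c , ls))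

edges-concatMap : ∀ {k} (σs : List (LabelledStar k)) →
  map proj₂ (concatMap labelledEdgesOf σs) ≡ concatMap (starEdges ∘ shape) σs
edges-concatMap [] = refl
edges-concatMap (σ ∷ σs) = trans (map-++ proj₂ (labelledEdgesOf σ) (concatMap labelledEdgesOf σs))
  (cong₂ _++_ (edges-labelledEdgesOf σ) (edges-concatMap σs))

diffsWithLabel-++ : ∀ g ℓ xs ys →
  diffsWithLabel g ℓ (xs ++ ys) ≡ diffsWithLabel g ℓ xs ++ diffsWithLabel g ℓ ys
diffsWithLabel-++ g ℓ [] ys = refl
diffsWithLabel-++ g ℓ ((ℓ′ , e) ∷ xs) ys with sameLabel ℓ ℓ′
... | true = cong (diff g e ∷_) (diffsWithLabel-++ g ℓ xs ys)
... | false = diffsWithLabel-++ g ℓ xs ys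

fwdCount-split : ∀ g d es → All (Forward g ∘ proj₂) es →
  fwdCount g d (map proj₂ es) ≡ occurrences d (diffsWithLabel g pure es) + occurrences d (diffsWithLabel g prime es)
fwdCount-split g d [] [] = refl
fwdCount-split g d ((pure , e) ∷ es) (fw ∷ fws) rewrite fw | ≡ᵇ-refl (dist e) | fwdCount-split g d es fws =
  sym (+-assoc (if dist e ≡ᵇ d then 1 else 0) (occurrences d (diffsWithLabel g pure es)) _)
fwdCount-split g d ((prime , e) ∷ es) (fw ∷ fws) rewrite fw | ≡ᵇ-refl (dist e) | fwdCount-split g d es fws =
  x∙yz≈y∙xz (if dist e ≡ᵇ d then 1 else 0) (occurrences d (diffsWithLabel g pure es)) _

module _ {g H : ℕ} (g≡ : g ≡ suc (H + H)) where

  ≤H⇒≤g∸ : ∀ {d} → d ≤ H → d ≤ g ∸ d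
  ≤H⇒≤g∸ {d} d≤H = begin
    d               ≤⟨ d≤H ⟩
    H               ≡⟨ sym (m+n∸n≡m H H) ⟩
    H + H ∸ H       ≤⟨ ∸-monoʳ-≤ (H + H) d≤H ⟩
    H + H ∸ d       ≤⟨ ∸-monoˡ-≤ d (n≤1+n (H + H)) ⟩
    suc (H + H) ∸ d ≡⟨ cong (_∸ d) (sym g≡) ⟩
    g ∸ d           ∎
    where open ≤-Reasoning

  diff-short : ∀ c l {d} → ∣ c - l ∣ ≡ d → d ≤ H → diff g (c , l) ≡ d
  diff-short c l refl d≤H = m≤n⇒m⊓n≡m (≤H⇒≤g∸ d≤H)

  diffsWithLabel-short : ∀ {k} ℓ (σ : LabelledStar k) → Short H σ →
    diffsWithLabel g ℓ (labelledEdgesOf σ) ≡ diffsOf ℓ σ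
  diffsWithLabel-short ℓ (c , []) [] = refl
  diffsWithLabel-short ℓ (c , (l , ℓ′ , d) ∷ ls) ((dist≡ , d≤H) ∷ short) =
    cong₂ (λ x xs → if sameLabel ℓ ℓ′ then x ∷ xs else xs)
      (diff-short c l dist≡ d≤H) (diffsWithLabel-short ℓ (c , ls) short)

  forward-short : ∀ {k} (σ : LabelledStar k) → Short H σ → All (Forward g ∘ proj₂) (labelledEdgesOf σ)
  forward-short (c , []) [] = []
  forward-short (c , (l , ℓ′ , d) ∷ ls) ((dist≡ , d≤H) ∷ short) =
    trans (diff-short c l dist≡ d≤H) (sym dist≡) ∷ forward-short (c , ls) short

  diffsWithLabel-concatMap : ∀ {k} ℓ (σs : List (LabelledStar k)) → All (Short H) σs →
    diffsWithLabel g ℓ (concatMap labelledEdgesOf σs) ≡ concatMap (diffsOf ℓ) σs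
  diffsWithLabel-concatMap ℓ [] [] = refl
  diffsWithLabel-concatMap ℓ (σ ∷ σs) (short ∷ shorts) =
    trans (diffsWithLabel-++ g ℓ (labelledEdgesOf σ) _)
      (cong₂ _++_ (diffsWithLabel-short ℓ σ short) (diffsWithLabel-concatMap ℓ σs shorts))

  forward-concatMap : ∀ {k} (σs : List (LabelledStar k)) → All (Short H) σs →
    All (Forward g ∘ proj₂) (concatMap labelledEdgesOf σs)
  forward-concatMap [] [] = []
  forward-concatMap (σ ∷ σs) (short ∷ shorts) = All.++⁺ (forward-short σ short) (forward-concatMap σs shorts)

starWith : (ℕ → Label) → ℕ → ℕ → LabelledStar 5
starWith lab c x = c , five (λ t → c + (x + t) , lab t , x + t)

star : Label → ℕ → ℕ → LabelledStar 5
star ℓ = starWith (λ _ → ℓ)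

starWith-short : ∀ {H} lab c x → x + 4 ≤ H → Short H (starWith lab c x)
starWith-short lab c x x+4≤H = five⁺ {h = λ t → c + (x + t) , lab t , x + t}
  λ t<5 → ∣m-m+n∣≡n c _ , ≤-trans (+-monoʳ-≤ x (s≤s⁻¹ t<5)) x+4≤H

∈-starWith : ∀ lab c x {v} → v ≡ c ⊎ (c + x ≤ v × v < c + x + 5) → v ∈ vertices (starWith lab c x)
∈-starWith lab c x (inj₁ refl) = here refl
∈-starWith lab c x (inj₂ (lo , hi)) with window-offset lo hi
... | t , t<5 , refl rewrite +-assoc c x t = there (∈-five (λ t → c + (x + t)) t<5)

diffsOf-star : ∀ ℓ c x → diffsOf ℓ (star ℓ c x) ≡ toList (five (x +_))
diffsOf-star pure c x = refl
diffsOf-star prime c x = refl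

diffsOf-star-≢ : ∀ {ℓ′ ℓ} c x → ℓ′ ≢ ℓ → diffsOf ℓ′ (star ℓ c x) ≡ []
diffsOf-star-≢ {pure} {pure} c x ℓ′≢ℓ = ⊥-elim (ℓ′≢ℓ refl)
diffsOf-star-≢ {pure} {prime} c x _ = refl
diffsOf-star-≢ {prime} {pure} c x _ = refl
diffsOf-star-≢ {prime} {prime} c x ℓ′≢ℓ = ⊥-elim (ℓ′≢ℓ refl)

star-¬Mixed : ∀ ℓ c x → ¬ Mixed (labels (star ℓ c x))
star-¬Mixed ℓ c x = uniform⇒¬Mixed (labels (star ℓ c x)) (five⁺ λ _ → refl)

∈-starWith-block : ∀ lab c {v} → c ≤ v → v < c + 6 → v ∈ vertices (starWith lab c 1)
∈-starWith-block lab c {v} c≤v v<c+6 with c ≟ v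
... | yes refl = here refl
... | no c≢v = ∈-starWith lab c 1
  (inj₂ (subst (_≤ v) (sym (+-comm c 1)) (≤∧≢⇒< c≤v c≢v) , subst (v <_) (sym (+-assoc c 1 5)) v<c+6))

-- n stars of label ℓ with centres a, …, a + n - 1, whose leaves fill [a + n + w, a + 6n + w):
-- the star with centre a + i realises the differences 1 + w + 6 (n - 1 - i) + t for t < 5.
family : Label → ℕ → ℕ → ℕ → List (LabelledStar 5)
family ℓ w a zero = []
family ℓ w a (suc n) = star ℓ a (suc w + 6 * n) ∷ family ℓ w (suc a) n

blocks : ℕ → ℕ → List ℕ
blocks w zero = []
blocks w (suc n) = toList (five (suc w + 6 * n +_)) ++ blocks w n

module _ (ℓ : Label) (w : ℕ) where

  family-length : ∀ a n → length (family ℓ w a n) ≡ n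
  family-length a zero = refl
  family-length a (suc n) = cong suc (family-length (suc a) n)

  family-short : ∀ {H} a n → w + 6 * n ≤ suc H → All (Short H) (family ℓ w a n)
  family-short a zero _ = []
  family-short {H} a (suc n) bound =
    starWith-short (λ _ → ℓ) a (suc w + 6 * n) (+-cancelˡ-≤ 1 _ _ (subst (_≤ suc H) (top≡ w n) bound))
      ∷ family-short (suc a) n (≤-trans (+-monoʳ-≤ w (*-monoʳ-≤ 6 (n≤1+n n))) bound)
    where
    top≡ : ∀ w n → w + 6 * suc n ≡ 1 + (suc w + 6 * n + 4)
    top≡ = solve-∀

  family-diffs : ∀ a n → concatMap (diffsOf ℓ) (family ℓ w a n) ≡ blocks w n
  family-diffs a zero = refl
  family-diffs a (suc n) = cong₂ _++_ (diffsOf-star ℓ a (suc w + 6 * n)) (family-diffs (suc a) n)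

  family-diffs-≢ : ∀ {ℓ′} a n → ℓ′ ≢ ℓ → concatMap (diffsOf ℓ′) (family ℓ w a n) ≡ []
  family-diffs-≢ a zero _ = refl
  family-diffs-≢ a (suc n) ℓ′≢ℓ =
    cong₂ _++_ (diffsOf-star-≢ a (suc w + 6 * n) ℓ′≢ℓ) (family-diffs-≢ (suc a) n ℓ′≢ℓ)

  family-¬Mixed : ∀ a n → All (¬_ ∘ Mixed ∘ labels) (family ℓ w a n)
  family-¬Mixed a zero = []
  family-¬Mixed a (suc n) = star-¬Mixed ℓ a (suc w + 6 * n) ∷ family-¬Mixed (suc a) n

  ∈-family-centres : ∀ a n {v} → a ≤ v → v < a + n → v ∈ concatMap vertices (family ℓ w a n)
  ∈-family-centres a zero a≤v v<a+0 = ⊥-elim (<⇒≱ v<a+0 (≤-trans (≤-reflexive (+-identityʳ a)) a≤v))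
  ∈-family-centres a (suc n) {v} a≤v v<a+1+n with a ≟ v
  ... | yes refl = here refl
  ... | no a≢v = ∈-++⁺ʳ (vertices (star ℓ a _))
    (∈-family-centres (suc a) n (≤∧≢⇒< a≤v a≢v) (subst (v <_) (+-suc a n) v<a+1+n))

  ∈-family-leaves : ∀ a n {v} → a + n + w ≤ v → v < a + 6 * n + w → v ∈ concatMap vertices (family ℓ w a n)
  ∈-family-leaves a zero lo hi = ⊥-elim (<⇒≱ hi lo)
  ∈-family-leaves a (suc n) {v} lo hi with v <? suc a + 6 * n + w
  ... | yes v<rest = ∈-++⁺ʳ (vertices (star ℓ a _))
    (∈-family-leaves (suc a) n (subst (_≤ v) (lo≡ a n w) lo) v<rest)
    where
    lo≡ : ∀ a n w → a + suc n + w ≡ suc a + n + w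
    lo≡ = solve-∀
  ... | no v≮rest = ∈-++⁺ˡ (∈-starWith (λ _ → ℓ) a (suc w + 6 * n)
    (inj₂ (subst (_≤ v) (top≡ a n w) (≮⇒≥ v≮rest) , subst (v <_) (end≡ a n w) hi)))
    where
    top≡ : ∀ a n w → suc a + 6 * n + w ≡ a + (suc w + 6 * n)
    top≡ = solve-∀
    end≡ : ∀ a n w → a + 6 * suc n + w ≡ a + (suc w + 6 * n) + 5
    end≡ = solve-∀

blocks-≥ : ∀ w n → All (suc w ≤_) (blocks w n)
blocks-≥ w zero = []
blocks-≥ w (suc n) = All.++⁺ (five⁺ λ {t} _ → ≤-trans (m≤m+n (suc w) (6 * n)) (m≤m+n _ t)) (blocks-≥ w n)

blocks-< : ∀ w n → All (_< w + 6 * n) (blocks w n)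
blocks-< w zero = []
blocks-< w (suc n) =
  All.++⁺ (five⁺ λ t<5 → <-≤-trans (+-monoʳ-< (suc w + 6 * n) t<5) (≤-reflexive (next≡ w n)))
          (All.map (λ d< → <-≤-trans d< (+-monoʳ-≤ w (*-monoʳ-≤ 6 (n≤1+n n)))) (blocks-< w n))
  where
  next≡ : ∀ w n → suc w + 6 * n + 5 ≡ w + 6 * suc n
  next≡ = solve-∀

blocks-unique : ∀ w n → Unique (blocks w n)
blocks-unique w zero = []
blocks-unique w (suc n) = unique-++-above (suc w + 6 * n) (five-unique (+-cancelˡ-≡ (suc w + 6 * n) _ _))
  (blocks-unique w n) (five⁺ λ {t} _ → m≤m+n _ t) (All.map m<n⇒m<1+n (blocks-< w n))

-- A length 6 + 6k + t lies in the k-th prime block when t < 5 and in the k-th pure block when t = 5.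
blocks-cover : ∀ n {d} → 6 ≤ d → d < 6 + 6 * n → d ∈ blocks 5 n ⊎ d ∈ blocks 6 n
blocks-cover zero 6≤d d<6 = ⊥-elim (<⇒≱ d<6 (≤-trans (≤-reflexive (+-identityʳ 6)) 6≤d))
blocks-cover (suc n) {d} 6≤d d<end with d <? 6 + 6 * n
... | yes d<6+6n = Data.Sum.map (∈-++⁺ʳ _) (∈-++⁺ʳ _) (blocks-cover n 6≤d d<6+6n)
... | no d≮6+6n with window-offset (≮⇒≥ d≮6+6n) (subst (d <_) (end≡ n) d<end)
  where
  end≡ : ∀ n → 6 + 6 * suc n ≡ 6 + 6 * n + 6
  end≡ = solve-∀
...   | t , t<6 , refl with m<1+n⇒m<n∨m≡n t<6
...     | inj₁ t<5 = inj₁ (∈-++⁺ˡ (∈-five (6 + 6 * n +_) t<5))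
...     | inj₂ refl = inj₂ (∈-++⁺ˡ (subst (_∈ toList (five (7 + 6 * n +_))) (sym (shift≡ n))
                                   (∈-five (7 + 6 * n +_) (n<1+n 4))))
  where
  shift≡ : ∀ n → 6 + 6 * n + 5 ≡ 7 + 6 * n + 4
  shift≡ = solve-∀

length-vertices : ∀ {k} (σ : LabelledStar k) → length (vertices σ) ≡ suc k
length-vertices (c , ls) = cong suc (length-toList (vmap leafVertex ls))

length-concatMap-vertices : ∀ {k} (σs : List (LabelledStar k)) → length (concatMap vertices σs) ≡ suc k * length σs
length-concatMap-vertices {k} [] = sym (*-zeroʳ (suc k))
length-concatMap-vertices {k} (σ ∷ σs) =
  trans (length-++ (vertices σ))
    (trans (cong₂ _+_ (length-vertices σ) (length-concatMap-vertices σs)) (sym (*-suc (suc k) (length σs))))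

module _ {A : Set} where

  tabulate-lookup-cast : ∀ {B : Set} {n} (xs : List A) (eq : n ≡ length xs) (f : A → B) →
    tabulate (f ∘ lookup xs ∘ cast eq) ≡ map f xs
  tabulate-lookup-cast xs refl f = go xs
    where
    go : ∀ xs → tabulate (f ∘ lookup xs ∘ cast refl) ≡ map f xs
    go [] = refl
    go (x ∷ xs) = cong (f x ∷_) (go xs)

  exactly-head : ∀ {n} {P : A → Set} x xs (eq : n ≡ length (x ∷ xs)) → P x → All (¬_ ∘ P) xs →
    Σ (Fin n) λ i → P (lookup (x ∷ xs) (cast eq i)) × (∀ j → j ≢ i → ¬ P (lookup (x ∷ xs) (cast eq j)))
  exactly-head x xs refl px ¬pxs = zero , px , others
    where
    others : ∀ j → j ≢ zero → ¬ _
    others zero j≢0 = ⊥-elim (j≢0 refl)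
    others (suc j) _ = All.lookup ¬pxs (∈-lookup (cast refl j))

littleDiffs : List ℕ
littleDiffs = 4 ∷ 3 ∷ 2 ∷ 1 ∷ []

littleDiffs-unique : Unique littleDiffs
littleDiffs-unique = ((λ ()) ∷ (λ ()) ∷ (λ ()) ∷ []) ∷ ((λ ()) ∷ (λ ()) ∷ []) ∷ ((λ ()) ∷ []) ∷ [] ∷ []

littleDiffs-<5 : All (_< 5) littleDiffs
littleDiffs-<5 = n<1+n 4 ∷ m<n⇒m<1+n (n<1+n 3) ∷ s≤s (s≤s (s≤s z≤n)) ∷ s≤s (s≤s z≤n) ∷ []

∈-littleDiffs : ∀ {d} → 1 ≤ d → d < 5 → d ∈ littleDiffs
∈-littleDiffs {1} _ _ = there (there (there (here refl)))
∈-littleDiffs {2} _ _ = there (there (here refl))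
∈-littleDiffs {3} _ _ = there (here refl)
∈-littleDiffs {4} _ _ = here refl
∈-littleDiffs {suc (suc (suc (suc (suc _))))} _ (s≤s (s≤s (s≤s (s≤s (s≤s ())))))

DifferenceFactor : ℕ → ℕ → Set
DifferenceFactor g H =
  Σ (AlmostFiveStarFactor g 5) λ F →
    ((d : ℕ) → 1 ≤ d → d ≤ H → 1 ≤ fwdCount g d (edges F)) ×
    ((d : ℕ) → 1 ≤ d → d ≤ H → fwdCount g d (edges F) ≤ 2) ×
    All (Forward g) (edges F) ×
    Σ (Labelling F) λ L →
      IsPurePrime F L × ExactlyOneMixed {F = F} L × PrimeStar (Labelling.littleLabels L)

-- Vertices from left to right: a special region [0, s); the pure centres; the special block
-- [c₁, c₁ + 6); the pure leaves; the special vertex y; the prime centres; the little star on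
-- [z, z + 5); the prime leaves; a special region [e, e + u).  X and Y cover the special vertices.
module Positions (s q p : ℕ) where

  c₁ y a z e : ℕ
  c₁ = s + q
  y = s + 6 * q + 6
  a = suc y
  z = a + p
  e = a + 6 * p + 5

module Layout (s q p u : ℕ) (X Y : LabelledStar 5) where

  open Positions s q p

  littleStar : LabelledStar 4
  littleStar = z , (z + 4 , prime , 4) ∷ (z + 3 , prime , 3) ∷ (z + 2 , prime , 2) ∷ (z + 1 , prime , 1) ∷ []

  rest : List (LabelledStar 5)
  rest = Y ∷ family pure 6 s q ++ family prime 5 a p

  starList : List (LabelledStar 5)
  starList = X ∷ rest

  Special : ℕ → Set
  Special v = v < s ⊎ (c₁ ≤ v × v < c₁ + 6) ⊎ v ≡ y ⊎ (e ≤ v × v < e + u)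

  pureDiffs primeDiffs : List ℕ
  pureDiffs = diffsOf pure X ++ diffsOf pure Y ++ blocks 6 q
  primeDiffs = diffsOf prime X ++ diffsOf prime Y ++ blocks 5 p ++ littleDiffs

  allVertices : List ℕ
  allVertices = concatMap vertices starList ++ vertices littleStar

  length-starList : length starList ≡ 2 + (q + p)
  length-starList = cong (2 +_) (trans (length-++ (family pure 6 s q))
    (cong₂ _+_ (family-length pure 6 s q) (family-length prime 5 a p)))

  ∈-littleStar : ∀ {v} → z ≤ v → v < z + 5 → v ∈ vertices littleStar
  ∈-littleStar lo hi with window-offset lo hi
  ... | 0 , _ , refl = here (+-identityʳ z)
  ... | 1 , _ , refl = there (there (there (there (here refl))))
  ... | 2 , _ , refl = there (there (there (here refl)))
  ... | 3 , _ , refl = there (there (here refl))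
  ... | 4 , _ , refl = there (here refl)
  ... | suc (suc (suc (suc (suc _)))) , s≤s (s≤s (s≤s (s≤s (s≤s ())))) , _

  module _ (specials : ∀ v → Special v → v ∈ vertices X ++ vertices Y) where

    private
      ∈-starList : ∀ {v} → v ∈ concatMap vertices starList → v ∈ allVertices
      ∈-starList = ∈-++⁺ˡ

      ∈-special : ∀ v → Special v → v ∈ allVertices
      ∈-special v sp with ∈-++⁻ (vertices X) (specials v sp)
      ... | inj₁ v∈X = ∈-starList (∈-++⁺ˡ v∈X)
      ... | inj₂ v∈Y = ∈-starList (∈-++⁺ʳ (vertices X) (∈-++⁺ˡ v∈Y))

      ∈-families : ∀ {v} → v ∈ concatMap vertices (family pure 6 s q ++ family prime 5 a p) → v ∈ allVertices
      ∈-families v∈ = ∈-starList (∈-++⁺ʳ (vertices X) (∈-++⁺ʳ (vertices Y) v∈))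

      ∈-pure : ∀ {v} → v ∈ concatMap vertices (family pure 6 s q) → v ∈ allVertices
      ∈-pure v∈ = ∈-families (subst (_ ∈_) (sym (concatMap-++ vertices (family pure 6 s q) _)) (∈-++⁺ˡ v∈))

      ∈-prime : ∀ {v} → v ∈ concatMap vertices (family prime 5 a p) → v ∈ allVertices
      ∈-prime v∈ = ∈-families (subst (_ ∈_) (sym (concatMap-++ vertices (family pure 6 s q) _))
        (∈-++⁺ʳ (concatMap vertices (family pure 6 s q)) v∈))

    ∈-allVertices : ∀ v → v < e + u → v ∈ allVertices
    ∈-allVertices v v<end with v <? s
    ... | yes v<s = ∈-special v (inj₁ v<s)
    ... | no v≮s with v <? c₁
    ... | yes v<c₁ = ∈-pure (∈-family-centres pure 6 s q (≮⇒≥ v≮s) v<c₁)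
    ... | no v≮c₁ with v <? c₁ + 6
    ... | yes v<c₁+6 = ∈-special v (inj₂ (inj₁ (≮⇒≥ v≮c₁ , v<c₁+6)))
    ... | no v≮c₁+6 with v <? y
    ... | yes v<y = ∈-pure (∈-family-leaves pure 6 s q (≮⇒≥ v≮c₁+6) v<y)
    ... | no v≮y with v ≟ y
    ... | yes v≡y = ∈-special v (inj₂ (inj₂ (inj₁ v≡y)))
    ... | no v≢y with v <? z
    ... | yes v<z = ∈-prime (∈-family-centres prime 5 a p (≤∧≢⇒< (≮⇒≥ v≮y) (v≢y ∘ sym)) v<z)
    ... | no v≮z with v <? z + 5
    ... | yes v<z+5 = ∈-++⁺ʳ (concatMap vertices starList) (∈-littleStar (≮⇒≥ v≮z) v<z+5)
    ... | no v≮z+5 with v <? e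
    ... | yes v<e = ∈-prime (∈-family-leaves prime 5 a p (≮⇒≥ v≮z+5) v<e)
    ... | no v≮e = ∈-special v (inj₂ (inj₂ (inj₂ (≮⇒≥ v≮e , v<end))))

  module Assembly
    (g H : ℕ) (g≡1+2H : g ≡ suc (H + H)) (g≡ : g ≡ 6 * (2 + (q + p)) + 5) (s+u≡5 : s + u ≡ 5)
    (pure-fits : 6 + 6 * q ≤ suc H) (prime-fits : 5 + 6 * p ≤ suc H)
    (X-short : Short H X) (Y-short : Short H Y) (X-mixed : Mixed (labels X)) (Y-unmixed : ¬ Mixed (labels Y))
    (specials : ∀ v → Special v → v ∈ vertices X ++ vertices Y)
    (pure-unique : Unique pureDiffs) (prime-unique : Unique primeDiffs)
    (cover : ∀ d → 1 ≤ d → d ≤ H → d ∈ pureDiffs ⊎ d ∈ primeDiffs)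
    where

    count≡ : (g ∸ 5) / 6 ≡ length starList
    count≡ = begin
      (g ∸ 5) / 6                     ≡⟨ cong (λ n → (n ∸ 5) / 6) g≡ ⟩
      (6 * (2 + (q + p)) + 5 ∸ 5) / 6 ≡⟨ cong (_/ 6) (m+n∸n≡m (6 * (2 + (q + p))) 5) ⟩
      6 * (2 + (q + p)) / 6           ≡⟨ cong (_/ 6) (*-comm 6 (2 + (q + p))) ⟩
      (2 + (q + p)) * 6 / 6           ≡⟨ m*n/n≡m (2 + (q + p)) 6 ⟩
      2 + (q + p)                     ≡⟨ sym length-starList ⟩
      length starList                 ∎
      where open ≡-Reasoning

    e+u≡g : e + u ≡ g
    e+u≡g = begin
      e + u                          ≡⟨ regroup s q p u ⟩
      (s + u) + 6 * (q + p) + 12     ≡⟨ cong (λ n → n + 6 * (q + p) + 12) s+u≡5 ⟩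
      5 + 6 * (q + p) + 12           ≡⟨ normalise q p ⟩
      6 * (2 + (q + p)) + 5          ≡⟨ sym g≡ ⟩
      g                              ∎
      where
      open ≡-Reasoning
      regroup : ∀ s q p u → suc (s + 6 * q + 6) + 6 * p + 5 + u ≡ (s + u) + 6 * (q + p) + 12
      regroup = solve-∀
      normalise : ∀ q p → 5 + 6 * (q + p) + 12 ≡ 6 * (2 + (q + p)) + 5
      normalise = solve-∀

    starAt : Fin ((g ∸ 5) / 6) → LabelledStar 5
    starAt = lookup starList ∘ cast count≡

    partition′ : concatMap starVertices (tabulate (shape ∘ starAt)) ++ starVertices (shape littleStar) ↭ upTo g
    partition′ = subst (λ vs → vs ++ starVertices (shape littleStar) ↭ upTo g) (sym vertices≡)
      (↭-upTo g allVertices length≡ (λ v v<g → ∈-allVertices specials v (subst (v <_) (sym e+u≡g) v<g)))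
      where
      vertices≡ : concatMap starVertices (tabulate (shape ∘ starAt)) ≡ concatMap vertices starList
      vertices≡ = cong concat (trans (map-tabulate (shape ∘ starAt) starVertices)
                                     (tabulate-lookup-cast starList count≡ vertices))
      length≡ : length allVertices ≡ g
      length≡ = begin
        length allVertices                             ≡⟨ length-++ (concatMap vertices starList) ⟩
        length (concatMap vertices starList) + 5       ≡⟨ cong (_+ 5) (length-concatMap-vertices starList) ⟩
        6 * length starList + 5                        ≡⟨ cong (λ n → 6 * n + 5) length-starList ⟩
        6 * (2 + (q + p)) + 5                          ≡⟨ sym g≡ ⟩
        g                                              ∎
        where open ≡-Reasoning

    factor : AlmostFiveStarFactor g 5
    factor = record { t≥1 = s≤s z≤n ; stars = shape ∘ starAt ; little = shape littleStar ; partition = partition′ }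

    labelling : Labelling factor
    labelling = record { starLabels = labels ∘ starAt ; littleLabels = labels littleStar }

    labelledEdgeList : List (Label × (ℕ × ℕ))
    labelledEdgeList = concatMap labelledEdgesOf starList ++ labelledEdgesOf littleStar

    edges≡ : edges factor ≡ map proj₂ labelledEdgeList
    edges≡ = begin
      concatMap starEdges (tabulate (shape ∘ starAt)) ++ starEdges (shape littleStar)
        ≡⟨ cong (λ es → concat es ++ _) (trans (map-tabulate (shape ∘ starAt) starEdges)
                                               (tabulate-lookup-cast starList count≡ (starEdges ∘ shape))) ⟩
      concatMap (starEdges ∘ shape) starList ++ starEdges (shape littleStar)
        ≡⟨ sym (cong₂ _++_ (edges-concatMap starList) (edges-labelledEdgesOf littleStar)) ⟩
      map proj₂ (concatMap labelledEdgesOf starList) ++ map proj₂ (labelledEdgesOf littleStar)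
        ≡⟨ sym (map-++ proj₂ (concatMap labelledEdgesOf starList) _) ⟩
      map proj₂ labelledEdgeList ∎
      where open ≡-Reasoning

    labelledEdges≡ : labelledEdges factor labelling ≡ labelledEdgeList
    labelledEdges≡ = cong (λ es → concat es ++ _)
      (trans (map-tabulate (λ i → i) (λ i → labelledStarEdges (shape (starAt i)) (labels (starAt i))))
             (tabulate-lookup-cast starList count≡ labelledEdgesOf))

    4≤H : 4 ≤ H
    4≤H = +-cancelˡ-≤ 1 4 H (≤-trans (m≤m+n 5 (6 * p)) prime-fits)

    stars-short : All (Short H) starList
    stars-short = X-short ∷ Y-short ∷ All.++⁺ (family-short pure 6 s q pure-fits) (family-short prime 5 a p prime-fits)

    little-short : Short H littleStar
    little-short = (∣m-m+n∣≡n z 4 , 4≤H) ∷ (∣m-m+n∣≡n z 3 , ≤-trans (n≤1+n 3) 4≤H)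
      ∷ (∣m-m+n∣≡n z 2 , ≤-trans (s≤s (s≤s z≤n)) 4≤H)
      ∷ (∣m-m+n∣≡n z 1 , ≤-trans (s≤s z≤n) 4≤H) ∷ []

    forward : All (Forward g ∘ proj₂) labelledEdgeList
    forward = All.++⁺ (forward-concatMap g≡1+2H starList stars-short) (forward-short g≡1+2H littleStar little-short)

    split : ∀ ℓ → diffsWithLabel g ℓ labelledEdgeList ≡ concatMap (diffsOf ℓ) starList ++ diffsOf ℓ littleStar
    split ℓ = trans (diffsWithLabel-++ g ℓ (concatMap labelledEdgesOf starList) _)
      (cong₂ _++_ (diffsWithLabel-concatMap g≡1+2H ℓ starList stars-short)
                  (diffsWithLabel-short g≡1+2H ℓ littleStar little-short))

    families : ∀ ℓ → concatMap (diffsOf ℓ) (family pure 6 s q ++ family prime 5 a p)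
                   ≡ concatMap (diffsOf ℓ) (family pure 6 s q) ++ concatMap (diffsOf ℓ) (family prime 5 a p)
    families ℓ = concatMap-++ (diffsOf ℓ) (family pure 6 s q) _

    pure-diffs : diffsWithLabel g pure labelledEdgeList ≡ pureDiffs
    pure-diffs = begin
      diffsWithLabel g pure labelledEdgeList
        ≡⟨ trans (split pure) (++-identityʳ _) ⟩
      diffsOf pure X ++ diffsOf pure Y ++ concatMap (diffsOf pure) (family pure 6 s q ++ family prime 5 a p)
        ≡⟨ cong (λ ds → diffsOf pure X ++ diffsOf pure Y ++ ds)
             (trans (families pure) (trans (cong₂ _++_ (family-diffs pure 6 s q) (family-diffs-≢ prime 5 a p λ ()))
                                           (++-identityʳ _))) ⟩
      pureDiffs ∎
      where open ≡-Reasoning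

    prime-diffs : diffsWithLabel g prime labelledEdgeList ≡ primeDiffs
    prime-diffs = begin
      diffsWithLabel g prime labelledEdgeList
        ≡⟨ split prime ⟩
      (diffsOf prime X ++ diffsOf prime Y ++ concatMap (diffsOf prime) (family pure 6 s q ++ family prime 5 a p)) ++ littleDiffs
        ≡⟨ cong (λ ds → (diffsOf prime X ++ diffsOf prime Y ++ ds) ++ littleDiffs)
             (trans (families prime) (cong₂ _++_ (family-diffs-≢ pure 6 s q λ ()) (family-diffs prime 5 a p))) ⟩
      (diffsOf prime X ++ diffsOf prime Y ++ blocks 5 p) ++ littleDiffs
        ≡⟨ ++-assoc (diffsOf prime X) _ _ ⟩
      diffsOf prime X ++ (diffsOf prime Y ++ blocks 5 p) ++ littleDiffs
        ≡⟨ cong (diffsOf prime X ++_) (++-assoc (diffsOf prime Y) _ _) ⟩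
      primeDiffs ∎
      where open ≡-Reasoning

    fwdCount≡ : ∀ d → fwdCount g d (edges factor) ≡ occurrences d pureDiffs + occurrences d primeDiffs
    fwdCount≡ d = begin
      fwdCount g d (edges factor)                 ≡⟨ cong (fwdCount g d) edges≡ ⟩
      fwdCount g d (map proj₂ labelledEdgeList)   ≡⟨ fwdCount-split g d labelledEdgeList forward ⟩
      occurrences d (diffsWithLabel g pure labelledEdgeList) + occurrences d (diffsWithLabel g prime labelledEdgeList)
        ≡⟨ cong₂ (λ xs ys → occurrences d xs + occurrences d ys) pure-diffs prime-diffs ⟩
      occurrences d pureDiffs + occurrences d primeDiffs ∎
      where open ≡-Reasoning

    at-least-once : ∀ d → 1 ≤ d → d ≤ H → 1 ≤ fwdCount g d (edges factor)
    at-least-once d 1≤d d≤H = ≤-trans (once (cover d 1≤d d≤H)) (≤-reflexive (sym (fwdCount≡ d)))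
      where
      once : d ∈ pureDiffs ⊎ d ∈ primeDiffs → 1 ≤ occurrences d pureDiffs + occurrences d primeDiffs
      once (inj₁ d∈pure) = ≤-trans (occurrences-∈ d pureDiffs d∈pure) (m≤m+n _ _)
      once (inj₂ d∈prime) = ≤-trans (occurrences-∈ d primeDiffs d∈prime) (m≤n+m _ _)

    at-most-twice : ∀ d → 1 ≤ d → d ≤ H → fwdCount g d (edges factor) ≤ 2
    at-most-twice d _ _ = ≤-trans (≤-reflexive (fwdCount≡ d))
      (+-mono-≤ (occurrences-unique d pureDiffs pure-unique) (occurrences-unique d primeDiffs prime-unique))

    pure-prime : IsPurePrime factor labelling
    pure-prime = subst Unique (sym (trans (cong (diffsWithLabel g pure) labelledEdges≡) pure-diffs)) pure-unique
               , subst Unique (sym (trans (cong (diffsWithLabel g prime) labelledEdges≡) prime-diffs)) prime-unique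

    differenceFactor : DifferenceFactor g H
    differenceFactor =
      factor , at-least-once , at-most-twice , subst (All (Forward g)) (sym edges≡) (All.map⁺ forward) ,
      labelling , pure-prime ,
      exactly-head X rest count≡ X-mixed
        (Y-unmixed ∷ All.++⁺ (family-¬Mixed pure 6 s q) (family-¬Mixed prime 5 a p)) ,
      refl ∷ refl ∷ refl ∷ refl ∷ []

differenceFactor-12p+17 : ∀ p → DifferenceFactor (12 * p + 17) (6 * p + 8)
differenceFactor-12p+17 p =
  Assembly.differenceFactor (12 * p + 17) H (g≡1+2H p) (g≡ p) refl (pure-fits p) (prime-fits p)
    X-short Y-short (here refl , there (there (here refl))) (star-¬Mixed pure c₁ 1)
    specials pure-unique prime-unique cover
  where
  open Positions 2 p p

  x₀ H : ℕ
  x₀ = 6 + 6 * p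
  H = 6 * p + 8

  X Y : LabelledStar 5
  X = y , (0 , pure , x₀ + 2) ∷ (1 , pure , x₀ + 1)
        ∷ (e + 2 , prime , x₀ + 2) ∷ (e + 1 , prime , x₀ + 1) ∷ (e + 0 , prime , x₀ + 0) ∷ []
  Y = star pure c₁ 1

  open Layout 2 p p 3 X Y

  g≡1+2H : ∀ p → 12 * p + 17 ≡ suc (6 * p + 8 + (6 * p + 8))
  g≡1+2H = solve-∀
  g≡ : ∀ p → 12 * p + 17 ≡ 6 * (2 + (p + p)) + 5
  g≡ = solve-∀
  pure-fits : ∀ p → 6 + 6 * p ≤ suc (6 * p + 8)
  pure-fits p = subst (6 + 6 * p ≤_) (sym (fits≡ p)) (m≤m+n (6 + 6 * p) 3)
    where
    fits≡ : ∀ p → suc (6 * p + 8) ≡ 6 + 6 * p + 3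
    fits≡ = solve-∀
  prime-fits : ∀ p → 5 + 6 * p ≤ suc (6 * p + 8)
  prime-fits p = ≤-trans (n≤1+n _) (pure-fits p)

  x₀+t≤H : ∀ {t} → t ≤ 2 → x₀ + t ≤ H
  x₀+t≤H t≤2 = ≤-trans (+-monoʳ-≤ x₀ t≤2) (≤-reflexive (top≡ p))
    where
    top≡ : ∀ p → 6 + 6 * p + 2 ≡ 6 * p + 8
    top≡ = solve-∀

  X-short : Short H X
  X-short = (m≡n+o⇒∣m-n∣≡o y 0 (y≡0+ p) , x₀+t≤H ≤-refl)
          ∷ (m≡n+o⇒∣m-n∣≡o y 1 (y≡1+ p) , x₀+t≤H (n≤1+n 1))
          ∷ (n≡m+o⇒∣m-n∣≡o y (e + 2) (e+t≡ p 2) , x₀+t≤H ≤-refl)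
          ∷ (n≡m+o⇒∣m-n∣≡o y (e + 1) (e+t≡ p 1) , x₀+t≤H (n≤1+n 1))
          ∷ (n≡m+o⇒∣m-n∣≡o y (e + 0) (e+t≡ p 0) , x₀+t≤H z≤n) ∷ []
    where
    y≡0+ : ∀ p → 2 + 6 * p + 6 ≡ 0 + (6 + 6 * p + 2)
    y≡0+ = solve-∀
    y≡1+ : ∀ p → 2 + 6 * p + 6 ≡ 1 + (6 + 6 * p + 1)
    y≡1+ = solve-∀
    e+t≡ : ∀ p t → suc (2 + 6 * p + 6) + 6 * p + 5 + t ≡ 2 + 6 * p + 6 + (6 + 6 * p + t)
    e+t≡ = solve-∀

  Y-short : Short H Y
  Y-short = starWith-short (λ _ → pure) c₁ 1 (≤-trans (m≤m+n 5 3) (m≤n+m 8 (6 * p)))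

  specials : ∀ v → Special v → v ∈ vertices X ++ vertices Y
  specials 0 (inj₁ _) = there (here refl)
  specials 1 (inj₁ _) = there (there (here refl))
  specials (suc (suc _)) (inj₁ (s≤s (s≤s ())))
  specials v (inj₂ (inj₁ (lo , hi))) = ∈-++⁺ʳ (vertices X) (∈-starWith-block (λ _ → pure) c₁ lo hi)
  specials v (inj₂ (inj₂ (inj₁ refl))) = here refl
  specials v (inj₂ (inj₂ (inj₂ (lo , hi)))) with window-offset lo hi
  ... | 0 , _ , refl = there (there (there (there (there (here refl)))))
  ... | 1 , _ , refl = there (there (there (there (here refl))))
  ... | 2 , _ , refl = there (there (there (here refl)))
  ... | suc (suc (suc _)) , s≤s (s≤s (s≤s ())) , _

  small : List ℕ
  small = toList (five (1 +_))

  small<6 : All (_< 6) small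
  small<6 = five⁺ λ t<5 → +-monoʳ-< 1 t<5

  ∈-small : ∀ {d} → 1 ≤ d → d < 6 → d ∈ small
  ∈-small 1≤d d<6 with window-offset 1≤d d<6
  ... | t , t<5 , refl = ∈-five (1 +_) t<5

  pure-unique : Unique pureDiffs
  pure-unique = unique-++-above x₀ (((λ ()) ∘ +-cancelˡ-≡ x₀ 2 1 ∷ []) ∷ [] ∷ [])
    (unique-++-below 6 (five-unique (+-cancelˡ-≡ 1 _ _)) (blocks-unique 6 p)
                       small<6 (All.map (≤-trans (n≤1+n 6)) (blocks-≥ 6 p)))
    (m≤m+n x₀ 2 ∷ m≤m+n x₀ 1 ∷ [])
    (All.++⁺ (All.map (λ d<6 → <-≤-trans d<6 (m≤m+n 6 (6 * p))) small<6) (blocks-< 6 p))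

  prime-unique : Unique primeDiffs
  prime-unique = unique-++-above x₀
    (((λ ()) ∘ +-cancelˡ-≡ x₀ 2 1 ∷ (λ ()) ∘ +-cancelˡ-≡ x₀ 2 0 ∷ [])
      ∷ ((λ ()) ∘ +-cancelˡ-≡ x₀ 1 0 ∷ []) ∷ [] ∷ [])
    (unique-++-above 5 (blocks-unique 5 p) littleDiffs-unique
                       (All.map (≤-trans (n≤1+n 5)) (blocks-≥ 5 p)) littleDiffs-<5)
    (m≤m+n x₀ 2 ∷ m≤m+n x₀ 1 ∷ m≤m+n x₀ 0 ∷ [])
    (All.++⁺ (All.map m<n⇒m<1+n (blocks-< 5 p))
             (All.map (λ d<5 → <-≤-trans d<5 (≤-trans (n≤1+n 5) (m≤m+n 6 (6 * p)))) littleDiffs-<5))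

  cover : ∀ d → 1 ≤ d → d ≤ H → d ∈ pureDiffs ⊎ d ∈ primeDiffs
  cover d 1≤d d≤H with d <? 6
  ... | yes d<6 = inj₁ (there (there (∈-++⁺ˡ (∈-small 1≤d d<6))))
  ... | no d≮6 with d <? x₀
  ... | yes d<x₀ with blocks-cover p (≮⇒≥ d≮6) d<x₀
  ...   | inj₁ d∈prime = inj₂ (there (there (there (∈-++⁺ˡ d∈prime))))
  ...   | inj₂ d∈pure = inj₁ (there (there (∈-++⁺ʳ small d∈pure)))
  cover d 1≤d d≤H | no d≮6 | no d≮x₀ with window-offset (≮⇒≥ d≮x₀) d<x₀+3
    where
    d<x₀+3 : d < x₀ + 3
    d<x₀+3 = subst (d <_) (sym (trans (+-suc x₀ 2) (cong suc (top≡ p)))) (s≤s d≤H)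
      where
      top≡ : ∀ p → 6 + 6 * p + 2 ≡ 6 * p + 8
      top≡ = solve-∀
  ... | 0 , _ , refl = inj₂ (there (there (here refl)))
  ... | 1 , _ , refl = inj₂ (there (here refl))
  ... | 2 , _ , refl = inj₂ (here refl)
  ... | suc (suc (suc _)) , s≤s (s≤s (s≤s ())) , _

differenceFactor-12p+23 : ∀ p → DifferenceFactor (12 * p + 23) (6 * p + 11)
differenceFactor-12p+23 p =
  Assembly.differenceFactor (12 * p + 23) H (g≡1+2H p) (g≡ p) refl (≤-reflexive (pure-fits p)) prime-fits
    X-short Y-short (there (here refl) , here refl) (star-¬Mixed prime y x₀)
    specials pure-unique prime-unique cover
  where
  open Positions 0 (suc p) p

  x₀ H : ℕ
  x₀ = 6 + 6 * p
  H = 6 * p + 11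

  onlyFivePrime : ℕ → Label
  onlyFivePrime 4 = prime
  onlyFivePrime _ = pure

  X Y : LabelledStar 5
  X = starWith onlyFivePrime c₁ 1
  Y = star prime y x₀

  open Layout 0 (suc p) p 5 X Y

  g≡1+2H : ∀ p → 12 * p + 23 ≡ suc (6 * p + 11 + (6 * p + 11))
  g≡1+2H = solve-∀
  g≡ : ∀ p → 12 * p + 23 ≡ 6 * (2 + (suc p + p)) + 5
  g≡ = solve-∀
  pure-fits : ∀ p → 6 + 6 * suc p ≡ suc (6 * p + 11)
  pure-fits = solve-∀

  prime-fits : 5 + 6 * p ≤ suc H
  prime-fits = ≤-trans (m≤m+n (5 + 6 * p) 7) (≤-reflexive (fits≡ p))
    where
    fits≡ : ∀ p → 5 + 6 * p + 7 ≡ suc (6 * p + 11)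
    fits≡ = solve-∀

  X-short : Short H X
  X-short = starWith-short onlyFivePrime c₁ 1 (≤-trans (m≤m+n 5 6) (m≤n+m 11 (6 * p)))

  Y-short : Short H Y
  Y-short = starWith-short (λ _ → prime) y x₀ (≤-trans (m≤m+n (x₀ + 4) 1) (≤-reflexive (top≡ p)))
    where
    top≡ : ∀ p → 6 + 6 * p + 4 + 1 ≡ 6 * p + 11
    top≡ = solve-∀

  specials : ∀ v → Special v → v ∈ vertices X ++ vertices Y
  specials v (inj₁ ())
  specials v (inj₂ (inj₁ (lo , hi))) = ∈-++⁺ˡ (∈-starWith-block onlyFivePrime c₁ lo hi)
  specials v (inj₂ (inj₂ (inj₁ refl))) = ∈-++⁺ʳ (vertices X) (here refl)
  specials v (inj₂ (inj₂ (inj₂ (lo , hi)))) = ∈-++⁺ʳ (vertices X)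
    (∈-starWith (λ _ → prime) y x₀ (inj₂ (subst (_≤ v) (e≡ p) lo , subst (λ n → v < n + 5) (e≡ p) hi)))
    where
    e≡ : ∀ p → suc (0 + 6 * suc p + 6) + 6 * p + 5 ≡ 0 + 6 * suc p + 6 + (6 + 6 * p)
    e≡ = solve-∀

  pure-unique : Unique pureDiffs
  pure-unique = unique-++-below 5 littleDiffs-unique (blocks-unique 6 (suc p)) littleDiffs-<5
    (All.map (≤-trans (m≤m+n 5 2)) (blocks-≥ 6 (suc p)))

  prime-unique : Unique primeDiffs
  prime-unique = All.++⁺ (All.map <⇒≢ (blocks-≥ 5 (suc p))) (All.map >⇒≢ littleDiffs-<5)
    ∷ unique-++-above 5 (blocks-unique 5 (suc p)) littleDiffs-unique
                        (All.map (≤-trans (n≤1+n 5)) (blocks-≥ 5 (suc p))) littleDiffs-<5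

  cover : ∀ d → 1 ≤ d → d ≤ H → d ∈ pureDiffs ⊎ d ∈ primeDiffs
  cover d 1≤d d≤H with d <? 5
  ... | yes d<5 = inj₁ (∈-++⁺ˡ (∈-littleDiffs 1≤d d<5))
  ... | no d≮5 with d ≟ 5
  ... | yes refl = inj₂ (here refl)
  ... | no d≢5 with blocks-cover (suc p) (≤∧≢⇒< (≮⇒≥ d≮5) (d≢5 ∘ sym))
                                          (subst (d <_) (sym (pure-fits p)) (s≤s d≤H))
  ...   | inj₁ d∈prime = inj₂ (there (∈-++⁺ˡ d∈prime))
  ...   | inj₂ d∈pure = inj₁ (∈-++⁺ʳ littleDiffs d∈pure)

even-or-odd : ∀ m → (∃ λ j → m ≡ 2 * j) ⊎ (∃ λ j → m ≡ 1 + 2 * j)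
even-or-odd zero = inj₁ (0 , refl)
even-or-odd (suc m) with even-or-odd m
... | inj₁ (j , refl) = inj₂ (j , refl)
... | inj₂ (j , refl) = inj₁ (suc j , cong suc (sym (+-suc j (j + 0))))

lemma3p3 : (m : ℕ) → 1 ≤ m →
    Σ (AlmostFiveStarFactor (30 * m + 17) 5) λ F →
      ((d : ℕ) → 1 ≤ d → d ≤ 15 * m + 8 → 1 ≤ fwdCount (30 * m + 17) d (edges F)) ×
      ((d : ℕ) → 1 ≤ d → d ≤ 15 * m + 8 → fwdCount (30 * m + 17) d (edges F) ≤ 2) ×
      All (Forward (30 * m + 17)) (edges F) ×
      Σ (Labelling F) λ L →
        IsPurePrime F L × ExactlyOneMixed {F = F} L × PrimeStar (Labelling.littleLabels L)
lemma3p3 m _ with even-or-odd m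
... | inj₁ (j , refl) = subst₂ DifferenceFactor (g≡ j) (H≡ j) (differenceFactor-12p+17 (5 * j))
  where
  g≡ : ∀ j → 12 * (5 * j) + 17 ≡ 30 * (2 * j) + 17
  g≡ = solve-∀
  H≡ : ∀ j → 6 * (5 * j) + 8 ≡ 15 * (2 * j) + 8
  H≡ = solve-∀
... | inj₂ (j , refl) = subst₂ DifferenceFactor (g≡ j) (H≡ j) (differenceFactor-12p+23 (5 * j + 2))
  where
  g≡ : ∀ j → 12 * (5 * j + 2) + 23 ≡ 30 * (1 + 2 * j) + 17
  g≡ = solve-∀
  H≡ : ∀ j → 6 * (5 * j + 2) + 11 ≡ 15 * (1 + 2 * j) + 8
  H≡ = solve-∀
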